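{- Let $n\ge M$ with $M\to\infty$. Let $\mathcal{M}_1\in\{ -1,1\}^{M\times n}$ have i.i.d. Rademacher entries and $m=\lceil 2n/M\rceil$. Generate $\mathcal{M}_2,\dots,\mathcal{M}_m\in\{ -1,1\}^{M\times n}$ by independently resampling (with fresh i.i.d. Rademacher entries) the last $M$ columns of $\mathcal{M}_1$, keeping the first $n-M$ columns identical. Let $\Xi_d(m,M)$ be the set of $m$-tuples $(\boldsymbol{\sigma}_1,\dots,\boldsymbol{\sigma}_m)\in\{ -1,1\}^{n\times m}$ such that $\max_{1\le i\le m}\|\mathcal{M}_i\boldsymbol{\sigma}_i\|_\infty\le\frac{1}{24}\sqrt{M}$ and $\boldsymbol{\sigma}_i(k)=\boldsymbol{\sigma}_j(k)$ for all $1\le i<j\le m$ and $1\le k\le n-M$. Then, for all sufficiently large $M$, \[\mathbb{P}\bigl[\Xi_d(m,M)=\varnothing\bigr]\ge 1-e^{ -n}.\] -}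

module Defs where

open import Data.Bool using (Bool; true; false; _∧_; not; if_then_else_)
open import Data.Nat as ℕ using (ℕ; zero; suc; _∸_; _^_; _!; _≤ᵇ_; NonZero)
open import Data.Nat.Properties using (_!≢0)
open import Data.Nat.DivMod using (_/_)
open import Data.Integer as ℤ using (ℤ; +_; ∣_∣)
open import Data.Rational as ℚ using (ℚ)
open import Data.Fin using (Fin; toℕ; splitAt)
open import Data.Sum using (_⊎_; inj₁; inj₂; [_,_]′)
open import Data.Product using (_×_; _,_)
open import Data.List using (List; []; _∷_; [_]; map; concatMap; cartesianProduct; length; filter; allFin; upTo; foldr)
open import Data.Vec.Functional using (Vector)
open import Data.Bool.ListAction using (all; any)
import Data.Vec.Functional as VF
open import Relation.Nullary.Decidable using (does)
open import Data.Bool.Properties using () renaming (_≟_ to _≟B_)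
open import Relation.Unary using (Decidable)

-- Signs: a Rademacher / ±1 entry is encoded as a Bool (true ↦ +1, false ↦ -1).

sgn : Bool → ℤ
sgn true  = + 1
sgn false = ℤ.-[1+ 0 ]

bools : List Bool
bools = true ∷ false ∷ []

allFuns : ∀ {A : Set} → List A → (k : ℕ) → List (Vector A k)
allFuns xs zero    = [ (λ ()) ]
allFuns xs (suc k) = concatMap (λ x → map (x VF.∷_) (allFuns xs k)) xs

Mat : ℕ → ℕ → Set
Mat r c = Fin r → Fin c → Bool

SignVec : ℕ → Set
SignVec c = Fin c → Bool

sumFin : ∀ c → (Fin c → ℤ) → ℤ
sumFin c f = foldr (λ k acc → f k ℤ.+ acc) (+ 0) (allFin c)

matVec : ∀ {r c} → Mat r c → SignVec c → Fin r → ℤ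
matVec {r} {c} A σ i = sumFin c (λ k → sgn (A i k) ℤ.* sgn (σ k))

allFinᵇ : ∀ n → (Fin n → Bool) → Bool
allFinᵇ n p = all p (allFin n)

-- ‖x‖∞ ≤ √M / 24 ; for a vector x of integers this is equivalent to
-- (24 |x_r|)² ≤ M for every coordinate r.
infNormSmall : ∀ {r} (M : ℕ) → (Fin r → ℤ) → Bool
infNormSmall {r} M x = allFinᵇ r (λ i → ((24 ℕ.* ∣ x i ∣) ^ 2) ≤ᵇ M)

-- We write n = a + M (a = n - M ≥ 0); column index
-- k : Fin (a + M) is split by splitAt a into the first a = n - M columns
-- (inj₁) and the last M columns (inj₂).
-- An outcome consists of the shared first n - M columns (an M × a matrix)
-- together with, for each i ∈ Fin m, an independent M × M block forming the
-- last M columns of 𝓜_i.  Block 0 belongs to 𝓜₁, blocks 1..m-1 are the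
-- fresh resamples for 𝓜₂,…,𝓜_m.  All entries are i.i.d. uniform ±1, i.e.
-- the uniform measure on this finite set of outcomes.

Outcome : (M a m : ℕ) → Set
Outcome M a m = Mat M a × (Fin m → Mat M M)

outcomes : (M a m : ℕ) → List (Outcome M a m)
outcomes M a m =
  cartesianProduct (allFuns (allFuns bools a) M)
                   (allFuns (allFuns (allFuns bools M) M) m)

design : ∀ {M a m} → Outcome M a m → Fin m → Mat M (a ℕ.+ M)
design {M} {a} (base , blocks) i r k = [ base r , blocks i r ]′ (splitAt a k)

isShared : ∀ a {M} → Fin (a ℕ.+ M) → Bool
isShared a k = [ (λ _ → true) , (λ _ → false) ]′ (splitAt a k)

_==_ : Bool → Bool → Bool
x == y = does (x ≟B y)

inΞ : ∀ {M a m} → Outcome M a m → (Fin m → SignVec (a ℕ.+ M)) → Bool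
inΞ {M} {a} {m} ω σ =
  allFinᵇ m (λ i → infNormSmall M (matVec (design ω i) (σ i)))
  ∧ allFinᵇ m (λ i → allFinᵇ m (λ j → allFinᵇ (a ℕ.+ M) (λ k →
      if (toℕ i ℕ.<ᵇ toℕ j) ∧ isShared a k then σ i k == σ j k else true)))

ΞEmpty : ∀ {M a m} → Outcome M a m → Bool
ΞEmpty {M} {a} {m} ω = not (any (inΞ ω) (allFuns (allFuns bools (a ℕ.+ M)) m))

prob : ∀ {Ω : Set} → List Ω → (Ω → Bool) → ℚ
prob []             P = ℚ.0ℚ
prob xs@(_ ∷ rest)  P = (+ length (filter (λ ω → P ω ≟B true) xs)) ℚ./ suc (length rest)

ceilDiv : (x d : ℕ) → .{{NonZero d}} → ℕ
ceilDiv x d = (x ℕ.+ (d ∸ 1)) / d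

expPartial : ℕ → ℕ → ℚ
expPartial n k = foldr (λ j acc → ((+ (n ^ j)) ℚ./ (j !)) {{j !≢0}} ℚ.+ acc) ℚ.0ℚ (upTo (suc k))

-- q ≤ e^{-n}  (for q ≥ 0 this is q · e^n ≤ 1, i.e. q · Σ_{j≤k} n^j/j! ≤ 1 for all k,
-- since these partial sums increase to e^n)
_≤e^-_ : ℚ → ℕ → Set
q ≤e^- n = ∀ k → q ℚ.* expPartial n k ℚ.≤ ℚ.1ℚ

-- Union bound over candidate solutions.  A candidate fixes the common first n - M
-- coordinates and the last M coordinates of each σᵢ, so there are 2^(n-M) · 2^(Mm)
-- of them.  For a fixed candidate, row r of the resampled block of 𝓜ᵢ contributes
-- s + ⟨b, τ⟩ to 𝓜ᵢσᵢ, with s fixed and b a fresh uniform sign vector.  Since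
-- ⟨b, τ⟩ = 2j - M when b agrees with τ in j places, only about √M/24 values of j keep
-- the row small, and each is attained by C(M, j) ≤ C(M, ⌊M/2⌋) ≲ 2^M/√M vectors b;
-- so a row is small with probability at most 1/16.  The Mm rows are independent,
-- and Mm ≥ 2n gives P(Ξ ≠ ∅) ≤ 2^(n-M+Mm) 16^(-Mm) ≤ 1/(2·16ⁿ) ≤ e^(-n), the last
-- step because n^j/j! ≤ 16ⁿ/2^j.

module Submission where

open import Defs
open import Data.Bool using (Bool; true; false; T; _∧_; _∨_; not; if_then_else_)
open import Data.Bool.ListAction using (and; any)
open import Data.Bool.Properties using (T-∧; T-≡; not-involutive) renaming (_≟_ to _≟ᵇ_)
open import Data.Empty using (⊥-elim)
open import Data.Fin as Fin using (Fin; zero; suc; toℕ; _↑ˡ_; _↑ʳ_)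
open import Data.Fin.Properties using (splitAt-↑ˡ; splitAt-↑ʳ)
open import Data.Integer as ℤ using (ℤ; +_; ∣_∣; +≤+)
import Data.Integer.Properties as ℤProp
import Data.Integer.Tactic.RingSolver as ℤSolver
open import Data.List using (List; []; _∷_; _++_; map; length; filter; concatMap; cartesianProduct; tabulate; foldr; allFin; upTo; applyUpTo)
import Data.List.Properties as List
open import Data.List.Membership.Propositional using (_∈_; lose)
open import Data.List.Membership.Propositional.Properties using (∈-map⁺; ∈-concatMap⁺; ∈-cartesianProduct⁺; ∈-filter⁺; ∈-upTo⁺)
open import Data.List.Relation.Unary.All.Properties using (all⁺; all⁻; tabulate⁺; tabulate⁻)
open import Data.List.Relation.Unary.Any using (here; there; satisfied)
open import Data.List.Relation.Unary.Any.Properties using (any⁺; any⁻)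
open import Data.Nat as ℕ using (ℕ; zero; suc; _+_; _*_; _^_; _≤_; _<_; _∸_; _!; z≤n; s≤s; s≤s⁻¹; s<s⁻¹; _≤ᵇ_; _<ᵇ_; _≡ᵇ_; ⌊_/2⌋; NonZero)
open import Data.Nat.Combinatorics using (_C_; nC1≡n; nCk≡nC[n∸k]; nCk+nC[k+1]≡[n+1]C[k+1])
open import Data.Nat.DivMod using (_%_; m≡m%n+[m/n]*n; m%n<n)
open import Data.Nat.ListAction using (sum)
open import Data.Nat.Properties
open import Data.Nat.Tactic.RingSolver using (solve-∀)
open import Data.Product using (Σ; ∃; _×_; _,_; proj₁; proj₂)
open import Data.Rational as ℚ using (ℚ; 0ℚ; 1ℚ; _-_; _/_; toℚᵘ)
import Data.Rational.Properties as ℚProp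
open import Data.Rational.Unnormalised as ℚᵘ using (mkℚᵘ; *≤*; *≡*)
import Data.Rational.Unnormalised.Properties as ℚᵘProp
open import Data.Sum using (_⊎_; inj₁; inj₂; [_,_]′)
open import Data.Unit using (tt)
import Data.Vec.Functional as Vector
open import Function using (_∘_; id; Equivalence)
open import Relation.Binary.PropositionalEquality
open import Relation.Nullary using (contradiction)

private variable
  A B : Set

count : (A → Bool) → List A → ℕ
count p = length ∘ filter (λ x → p x ≟ᵇ true)

count-++ : ∀ (p : A → Bool) xs ys → count p (xs ++ ys) ≡ count p xs + count p ys
count-++ p [] ys = refl
count-++ p (x ∷ xs) ys with p x
... | true  = cong suc (count-++ p xs ys)
... | false = count-++ p xs ys

count-cong : ∀ {p q : A → Bool} → (∀ x → p x ≡ q x) → ∀ xs → count p xs ≡ count q xs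
count-cong p≗q [] = refl
count-cong {p = p} {q = q} p≗q (x ∷ xs) with p x | q x | p≗q x
... | true  | true  | _ = cong suc (count-cong p≗q xs)
... | false | false | _ = count-cong p≗q xs

count-mono : ∀ {p q : A → Bool} → (∀ x → T (p x) → T (q x)) → ∀ xs → count p xs ≤ count q xs
count-mono p⇒q [] = z≤n
count-mono {p = p} {q = q} p⇒q (x ∷ xs) with p x | q x | p⇒q x
... | true  | true  | _  = s≤s (count-mono p⇒q xs)
... | true  | false | pq = ⊥-elim (pq tt)
... | false | true  | _  = m≤n⇒m≤1+n (count-mono p⇒q xs)
... | false | false | _  = count-mono p⇒q xs

count-∨ : ∀ (p q : A → Bool) xs → count (λ x → p x ∨ q x) xs ≤ count p xs + count q xs
count-∨ p q [] = z≤n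
count-∨ p q (x ∷ xs) with p x | q x
... | true  | true  = s≤s (≤-trans (count-∨ p q xs) (+-monoʳ-≤ (count p xs) (n≤1+n _)))
... | true  | false = s≤s (count-∨ p q xs)
... | false | true  = ≤-trans (s≤s (count-∨ p q xs)) (≤-reflexive (sym (+-suc _ _)))
... | false | false = count-∨ p q xs

count+count-not≡length : ∀ (p : A → Bool) xs → count p xs + count (not ∘ p) xs ≡ length xs
count+count-not≡length p [] = refl
count+count-not≡length p (x ∷ xs) with p x
... | true  = cong suc (count+count-not≡length p xs)
... | false = trans (+-suc _ _) (cong suc (count+count-not≡length p xs))

count-const-false : ∀ xs → count {A = A} (λ _ → false) xs ≡ 0
count-const-false [] = refl
count-const-false (_ ∷ xs) = count-const-false xs

count-map : ∀ (p : B → Bool) (f : A → B) xs → count p (map f xs) ≡ count (p ∘ f) xs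
count-map p f [] = refl
count-map p f (x ∷ xs) with p (f x)
... | true  = cong suc (count-map p f xs)
... | false = count-map p f xs

count-concatMap : ∀ (p : B → Bool) (g : A → List B) xs →
                  count p (concatMap g xs) ≡ sum (map (count p ∘ g) xs)
count-concatMap p g [] = refl
count-concatMap p g (x ∷ xs) =
  trans (count-++ p (g x) (concatMap g xs)) (cong (_+_ (count p (g x))) (count-concatMap p g xs))

count-cartesianProduct : ∀ (p : A × B → Bool) xs ys →
  count p (cartesianProduct xs ys) ≡ sum (map (λ x → count (λ y → p (x , y)) ys) xs)
count-cartesianProduct p [] ys = refl
count-cartesianProduct p (x ∷ xs) ys =
  trans (count-++ p (map (x ,_) ys) _) (cong₂ _+_ (count-map p (x ,_) ys) (count-cartesianProduct p xs ys))

count-any≤sum : ∀ (h : A → B → Bool) (ys : List B) xs →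
  count (λ x → any (h x) ys) xs ≤ sum (map (λ y → count (λ x → h x y) xs) ys)
count-any≤sum h [] xs = ≤-reflexive (count-const-false xs)
count-any≤sum h (y ∷ ys) xs =
  ≤-trans (count-∨ (λ x → h x y) (λ x → any (h x) ys) xs) (+-monoʳ-≤ _ (count-any≤sum h ys xs))

*-sum≤length* : ∀ c (f : A → ℕ) {N} → (∀ x → c * f x ≤ N) →
              ∀ xs → c * sum (map f xs) ≤ length xs * N
*-sum≤length* c f bound [] = ≤-reflexive (*-zeroʳ c)
*-sum≤length* c f bound (x ∷ xs) =
  ≤-trans (≤-reflexive (*-distribˡ-+ c (f x) _)) (+-mono-≤ (bound x) (*-sum≤length* c f bound xs))

T-allFinᵇ⁻ : ∀ n {p : Fin n → Bool} → T (allFinᵇ n p) → ∀ i → T (p i)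
T-allFinᵇ⁻ n {p} = tabulate⁻ ∘ all⁺ p (allFin n)

T-allFinᵇ⁺ : ∀ n {p : Fin n → Bool} → (∀ i → T (p i)) → T (allFinᵇ n p)
T-allFinᵇ⁺ n {p} = all⁻ p ∘ tabulate⁺

allFinᵇ-suc : ∀ n (p : Fin (suc n) → Bool) → allFinᵇ (suc n) p ≡ p zero ∧ allFinᵇ n (p ∘ suc)
allFinᵇ-suc n p =
  cong (λ bs → p zero ∧ and bs) (trans (List.map-tabulate suc p) (sym (List.map-tabulate id (p ∘ suc))))

sumFin-suc : ∀ n (f : Fin (suc n) → ℤ) → sumFin (suc n) f ≡ f zero ℤ.+ sumFin n (f ∘ suc)
sumFin-suc n f = cong (ℤ._+_ (f zero)) (begin
  foldr (λ k s → f k ℤ.+ s) (ℤ.+ 0) (tabulate suc)           ≡⟨ cong (foldr _ _) (List.map-tabulate id (Fin.suc {n})) ⟨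
  foldr (λ k s → f k ℤ.+ s) (ℤ.+ 0) (map suc (tabulate id))  ≡⟨ List.foldr-map _ (Fin.suc {n}) (ℤ.+ 0) (tabulate id) ⟩
  sumFin n (f ∘ suc)                                           ∎)
  where open ≡-Reasoning

sumFin-cong : ∀ n {f g : Fin n → ℤ} → (∀ i → f i ≡ g i) → sumFin n f ≡ sumFin n g
sumFin-cong zero    f≗g = refl
sumFin-cong (suc n) {f} {g} f≗g = begin
  sumFin (suc n) f              ≡⟨ sumFin-suc n f ⟩
  f zero ℤ.+ sumFin n (f ∘ suc) ≡⟨ cong₂ ℤ._+_ (f≗g zero) (sumFin-cong n (f≗g ∘ suc)) ⟩
  g zero ℤ.+ sumFin n (g ∘ suc) ≡⟨ sumFin-suc n g ⟨
  sumFin (suc n) g              ∎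
  where open ≡-Reasoning

sumFin-+ : ∀ a b (f : Fin (a + b) → ℤ) →
           sumFin (a + b) f ≡ sumFin a (f ∘ (Fin._↑ˡ b)) ℤ.+ sumFin b (f ∘ (a Fin.↑ʳ_))
sumFin-+ zero    b f = sym (ℤProp.+-identityˡ _)
sumFin-+ (suc a) b f = begin
  sumFin (suc a + b) f                                                   ≡⟨ sumFin-suc (a + b) f ⟩
  f zero ℤ.+ sumFin (a + b) (f ∘ suc)                                    ≡⟨ cong (ℤ._+_ (f zero)) (sumFin-+ a b (f ∘ suc)) ⟩
  f zero ℤ.+ (sumFin a (f ∘ suc ∘ (Fin._↑ˡ b)) ℤ.+ sumFin b (f ∘ (suc a Fin.↑ʳ_))) ≡⟨ ℤProp.+-assoc (f zero) _ _ ⟨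
  (f zero ℤ.+ sumFin a (f ∘ suc ∘ (Fin._↑ˡ b))) ℤ.+ sumFin b (f ∘ (suc a Fin.↑ʳ_)) ≡⟨ cong (ℤ._+ sumFin b (f ∘ (suc a Fin.↑ʳ_))) (sumFin-suc a (f ∘ (Fin._↑ˡ b))) ⟨
  sumFin (suc a) (f ∘ (Fin._↑ˡ b)) ℤ.+ sumFin b (f ∘ (suc a Fin.↑ʳ_))             ∎
  where open ≡-Reasoning

-- Functions are only compared pointwise (there is no function extensionality).
allFuns-complete : ∀ (R : B → A → Set) (xs : List A) k (f : Fin k → B) →
  (∀ i → Σ A (λ x → x ∈ xs × R (f i) x)) →
  Σ (Fin k → A) (λ g → g ∈ allFuns xs k × (∀ i → R (f i) (g i)))
allFuns-complete R xs zero    f covered = (λ ()) , here refl , λ ()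
allFuns-complete R xs (suc k) f covered
  with covered zero | allFuns-complete R xs k (f ∘ suc) (covered ∘ suc)
... | x , x∈xs , Rx | g , g∈ , Rg =
  x Vector.∷ g ,
  ∈-concatMap⁺ (λ x → map (x Vector.∷_) (allFuns xs k)) (lose x∈xs (∈-map⁺ (x Vector.∷_) g∈)) ,
  λ { zero → Rx ; (suc i) → Rg i }

length-concatMap-const : ∀ (g : A → List B) {c} → (∀ x → length (g x) ≡ c) →
                         ∀ xs → length (concatMap g xs) ≡ length xs * c
length-concatMap-const g ∣gx∣≡c [] = refl
length-concatMap-const g ∣gx∣≡c (x ∷ xs) =
  trans (List.length-++ (g x)) (cong₂ _+_ (∣gx∣≡c x) (length-concatMap-const g ∣gx∣≡c xs))

length-allFuns : ∀ (xs : List A) k → length (allFuns xs k) ≡ length xs ^ k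
length-allFuns xs zero    = refl
length-allFuns xs (suc k) = length-concatMap-const _
  (λ x → trans (List.length-map (x Vector.∷_) (allFuns xs k)) (length-allFuns xs k)) xs

sum-count-∧ : ∀ (p : A → Bool) (q : B → Bool) xs ys →
              sum (map (λ x → count (λ y → p x ∧ q y) ys) xs) ≡ count p xs * count q ys
sum-count-∧ p q []       ys = refl
sum-count-∧ p q (x ∷ xs) ys with p x
... | true  = cong (_+_ (count q ys)) (sum-count-∧ p q xs ys)
... | false = trans (cong₂ _+_ (count-const-false ys) refl) (sum-count-∧ p q xs ys)

count-allFuns-suc : ∀ (xs : List A) k (P : Fin (suc k) → A → Bool) →
  count (λ f → allFinᵇ (suc k) (λ i → P i (f i))) (allFuns xs (suc k)) ≡
  count (P zero) xs * count (λ g → allFinᵇ k (λ i → P (suc i) (g i))) (allFuns xs k)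
count-allFuns-suc {A = A} xs k P = begin
  count all-P (concatMap (λ x → map (x Vector.∷_) (allFuns xs k)) xs)
    ≡⟨ count-concatMap all-P _ xs ⟩
  sum (map (λ x → count all-P (map (x Vector.∷_) (allFuns xs k))) xs)
    ≡⟨ cong sum (List.map-cong (λ x → trans (count-map all-P (x Vector.∷_) (allFuns xs k))
                                          (count-cong (λ g → allFinᵇ-suc k _) (allFuns xs k))) xs) ⟩
  sum (map (λ x → count (λ g → P zero x ∧ all-P∘suc g) (allFuns xs k)) xs)
    ≡⟨ sum-count-∧ (P zero) all-P∘suc xs (allFuns xs k) ⟩
  count (P zero) xs * count all-P∘suc (allFuns xs k) ∎
  where
  open ≡-Reasoning
  all-P : (Fin (suc k) → A) → Bool
  all-P f = allFinᵇ (suc k) (λ i → P i (f i))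
  all-P∘suc : (Fin k → A) → Bool
  all-P∘suc g = allFinᵇ k (λ i → P (suc i) (g i))

count-allFuns-all≤ : ∀ (xs : List A) k (P : Fin k → A → Bool) {c} → (∀ i → c * count (P i) xs ≤ length xs) →
                     c ^ k * count (λ f → allFinᵇ k (λ i → P i (f i))) (allFuns xs k) ≤ length (allFuns xs k)
count-allFuns-all≤ xs zero    P dense = ≤-refl
count-allFuns-all≤ xs (suc k) P {c} dense = begin
  c ^ suc k * count (λ f → allFinᵇ (suc k) (λ i → P i (f i))) (allFuns xs (suc k))
    ≡⟨ cong (c ^ suc k *_) (count-allFuns-suc xs k P) ⟩
  c * c ^ k * (count (P zero) xs * rest)
    ≡⟨ interchange c (c ^ k) (count (P zero) xs) rest ⟩
  c * count (P zero) xs * (c ^ k * rest)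
    ≤⟨ *-mono-≤ (dense zero) (count-allFuns-all≤ xs k (P ∘ suc) (dense ∘ suc)) ⟩
  length xs * length (allFuns xs k)
    ≡⟨ cong (length xs *_) (length-allFuns xs k) ⟩
  length xs ^ suc k
    ≡⟨ length-allFuns xs (suc k) ⟨
  length (allFuns xs (suc k)) ∎
  where
  open ≤-Reasoning
  rest = count (λ g → allFinᵇ k (λ i → P (suc i) (g i))) (allFuns xs k)
  interchange : ∀ a b c d → a * b * (c * d) ≡ a * c * (b * d)
  interchange = solve-∀

length-cartesianProduct : ∀ (xs : List A) (ys : List B) → length (cartesianProduct xs ys) ≡ length xs * length ys
length-cartesianProduct []       ys = refl
length-cartesianProduct (x ∷ xs) ys =
  trans (List.length-++ (map (x ,_) ys)) (cong₂ _+_ (List.length-map (x ,_) ys) (length-cartesianProduct xs ys))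

0<length-allFuns : ∀ (xs : List A) k → 0 < length xs → 0 < length (allFuns xs k)
0<length-allFuns xs zero    _       = s≤s z≤n
0<length-allFuns xs (suc k) 0<∣xs∣ =
  subst (0 <_) (sym (length-concatMap-const _ (λ x → List.length-map (x Vector.∷_) (allFuns xs k)) xs))
        (*-mono-≤ 0<∣xs∣ (0<length-allFuns xs k 0<∣xs∣))

-- Binomial coefficients

pascal : ∀ n k → suc n C suc k ≡ n C k + n C suc k
pascal n k = sym (nCk+nC[k+1]≡[n+1]C[k+1] n k)

C-absorb : ∀ n k → suc k * (suc n C suc k) ≡ suc n * (n C k)
C-absorb zero    zero    = refl
C-absorb zero    (suc k) = *-zeroʳ (suc (suc k))
C-absorb (suc n) zero    = trans (+-identityʳ _) (trans (nC1≡n (suc (suc n))) (sym (*-identityʳ _)))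
C-absorb (suc n) (suc k) = begin
  suc (suc k) * (suc (suc n) C suc (suc k))
    ≡⟨ cong (suc (suc k) *_) (pascal (suc n) (suc k)) ⟩
  suc (suc k) * (suc n C suc k + suc n C suc (suc k))
    ≡⟨ split (suc n C suc k) (suc n C suc (suc k)) ⟩
  suc n C suc k + suc k * (suc n C suc k) + suc (suc k) * (suc n C suc (suc k))
    ≡⟨ cong₂ (λ a b → suc n C suc k + a + b) (C-absorb n k) (C-absorb n (suc k)) ⟩
  suc n C suc k + suc n * (n C k) + suc n * (n C suc k)
    ≡⟨ merge (suc n C suc k) (n C k) (n C suc k) ⟩
  suc n C suc k + suc n * (n C k + n C suc k)
    ≡⟨ cong (λ x → suc n C suc k + suc n * x) (pascal n k) ⟨
  suc (suc n) * (suc n C suc k) ∎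
  where
  open ≡-Reasoning
  split : ∀ a b → suc (suc k) * (a + b) ≡ a + suc k * a + suc (suc k) * b
  split = solve-∀
  merge : ∀ a b c → a + suc n * b + suc n * c ≡ a + suc n * (b + c)
  merge = solve-∀

C-ratio : ∀ n k → suc k * (n C suc k) + suc k * (n C k) ≡ suc n * (n C k)
C-ratio n k = begin
  suc k * (n C suc k) + suc k * (n C k) ≡⟨ +-comm (suc k * (n C suc k)) _ ⟩
  suc k * (n C k) + suc k * (n C suc k) ≡⟨ *-distribˡ-+ (suc k) (n C k) (n C suc k) ⟨
  suc k * (n C k + n C suc k)           ≡⟨ cong (suc k *_) (pascal n k) ⟨
  suc k * (suc n C suc k)               ≡⟨ C-absorb n k ⟩
  suc n * (n C k)                       ∎
  where open ≡-Reasoning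

C-step-up : ∀ n k → suc (k + k) ≤ n → n C k ≤ n C suc k
C-step-up n k 2k<n = *-cancelˡ-≤ (suc k) (+-cancelʳ-≤ (suc k * (n C k)) _ _ (begin
  suc k * (n C k) + suc k * (n C k)     ≡⟨ *-distribʳ-+ (n C k) (suc k) (suc k) ⟨
  (suc k + suc k) * (n C k)             ≤⟨ *-monoˡ-≤ (n C k) (subst (_≤ suc n) (sym (+-suc (suc k) k)) (s≤s 2k<n)) ⟩
  suc n * (n C k)                       ≡⟨ C-ratio n k ⟨
  suc k * (n C suc k) + suc k * (n C k) ∎))
  where open ≤-Reasoning

C-step-down : ∀ n k → n ≤ suc (k + k) → n C suc k ≤ n C k
C-step-down n k n≤2k+1 = *-cancelˡ-≤ (suc k) (+-cancelʳ-≤ (suc k * (n C k)) _ _ (begin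
  suc k * (n C suc k) + suc k * (n C k) ≡⟨ C-ratio n k ⟩
  suc n * (n C k)                       ≤⟨ *-monoˡ-≤ (n C k) (subst (suc n ≤_) (sym (+-suc (suc k) k)) (s≤s n≤2k+1)) ⟩
  (suc k + suc k) * (n C k)             ≡⟨ *-distribʳ-+ (n C k) (suc k) (suc k) ⟩
  suc k * (n C k) + suc k * (n C k)     ∎))
  where open ≤-Reasoning

⌊n/2⌋-parity : ∀ n → n ≡ ⌊ n /2⌋ + ⌊ n /2⌋ ⊎ n ≡ suc (⌊ n /2⌋ + ⌊ n /2⌋)
⌊n/2⌋-parity zero          = inj₁ refl
⌊n/2⌋-parity (suc zero)    = inj₂ refl
⌊n/2⌋-parity (suc (suc n)) with ⌊n/2⌋-parity n
... | inj₁ even = inj₁ (cong suc (trans (cong suc even) (sym (+-suc _ _))))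
... | inj₂ odd  = inj₂ (cong suc (trans (cong suc odd) (cong suc (sym (+-suc _ _)))))

⌊n/2⌋+⌊n/2⌋≤n : ∀ n → ⌊ n /2⌋ + ⌊ n /2⌋ ≤ n
⌊n/2⌋+⌊n/2⌋≤n n with ⌊n/2⌋-parity n
... | inj₁ even = ≤-reflexive (sym even)
... | inj₂ odd  = ≤-trans (n≤1+n _) (≤-reflexive (sym odd))

n≤1+⌊n/2⌋+⌊n/2⌋ : ∀ n → n ≤ suc (⌊ n /2⌋ + ⌊ n /2⌋)
n≤1+⌊n/2⌋+⌊n/2⌋ n with ⌊n/2⌋-parity n
... | inj₁ even = ≤-trans (≤-reflexive even) (n≤1+n _)
... | inj₂ odd  = ≤-reflexive odd

C-mono-below-middle : ∀ n j d → j + d ≤ ⌊ n /2⌋ → n C j ≤ n C (j + d)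
C-mono-below-middle n j zero    _ = ≤-reflexive (cong (n C_) (sym (+-identityʳ j)))
C-mono-below-middle n j (suc d) j+d≤h = begin
  n C j             ≤⟨ C-mono-below-middle n j d (≤-trans (+-monoʳ-≤ j (n≤1+n d)) j+d≤h) ⟩
  n C (j + d)       ≤⟨ C-step-up n (j + d) 2[j+d]<n ⟩
  n C suc (j + d)   ≡⟨ cong (n C_) (+-suc j d) ⟨
  n C (j + suc d)   ∎
  where
  open ≤-Reasoning
  1+j+d≤h : suc (j + d) ≤ ⌊ n /2⌋
  1+j+d≤h = subst (_≤ ⌊ n /2⌋) (+-suc j d) j+d≤h
  2[j+d]<n : suc ((j + d) + (j + d)) ≤ n
  2[j+d]<n = ≤-trans (+-monoʳ-≤ (suc (j + d)) (n≤1+n (j + d)))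
                     (≤-trans (+-mono-≤ 1+j+d≤h 1+j+d≤h) (⌊n/2⌋+⌊n/2⌋≤n n))

C-anti-above-middle : ∀ n d → n C (⌊ n /2⌋ + d) ≤ n C ⌊ n /2⌋
C-anti-above-middle n zero    = ≤-reflexive (cong (n C_) (+-identityʳ ⌊ n /2⌋))
C-anti-above-middle n (suc d) = begin
  n C (h + suc d)  ≡⟨ cong (n C_) (+-suc h d) ⟩
  n C suc (h + d)  ≤⟨ C-step-down n (h + d) n≤2[h+d]+1 ⟩
  n C (h + d)      ≤⟨ C-anti-above-middle n d ⟩
  n C h            ∎
  where
  open ≤-Reasoning
  h = ⌊ n /2⌋
  n≤2[h+d]+1 : n ≤ suc ((h + d) + (h + d))
  n≤2[h+d]+1 = ≤-trans (n≤1+⌊n/2⌋+⌊n/2⌋ n) (s≤s (+-mono-≤ (m≤m+n h d) (m≤m+n h d)))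

C≤C-middle : ∀ n j → n C j ≤ n C ⌊ n /2⌋
C≤C-middle n j with ≤-total j ⌊ n /2⌋
... | inj₁ j≤h = subst (λ i → n C j ≤ n C i) (m+[n∸m]≡n j≤h)
                   (C-mono-below-middle n j (⌊ n /2⌋ ∸ j) (≤-reflexive (m+[n∸m]≡n j≤h)))
... | inj₂ h≤j = subst (λ i → n C i ≤ n C ⌊ n /2⌋) (m+[n∸m]≡n h≤j) (C-anti-above-middle n (j ∸ ⌊ n /2⌋))

central : ℕ → ℕ
central k = (k + k) C k

2k+1C[k+1]≡2k+1Ck : ∀ k → suc (k + k) C suc k ≡ suc (k + k) C k
2k+1C[k+1]≡2k+1Ck k = trans (nCk≡nC[n∸k] (s≤s (m≤m+n k k))) (cong (suc (k + k) C_) (m+n∸m≡n k k))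

central-suc : ∀ k → central (suc k) ≡ 2 * (suc (k + k) C k)
central-suc k = begin
  (suc k + suc k) C suc k                        ≡⟨ cong (_C suc k) (+-suc (suc k) k) ⟩
  suc (suc (k + k)) C suc k                      ≡⟨ pascal (suc (k + k)) k ⟩
  suc (k + k) C k + suc (k + k) C suc k          ≡⟨ cong (_+_ (suc (k + k) C k)) (2k+1C[k+1]≡2k+1Ck k) ⟩
  suc (k + k) C k + suc (k + k) C k              ≡⟨ cong (_+_ (suc (k + k) C k)) (+-identityʳ _) ⟨
  2 * (suc (k + k) C k)                          ∎
  where open ≡-Reasoning

central-recurrence : ∀ k → suc k * central (suc k) ≡ 2 * (suc (k + k) * central k)
central-recurrence k = begin
  suc k * central (suc k)                    ≡⟨ cong (suc k *_) (central-suc k) ⟩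
  suc k * (2 * (suc (k + k) C k))            ≡⟨ cong (λ x → suc k * (2 * x)) (2k+1C[k+1]≡2k+1Ck k) ⟨
  suc k * (2 * (suc (k + k) C suc k))        ≡⟨ swap (suc k) (suc (k + k) C suc k) ⟩
  2 * (suc k * (suc (k + k) C suc k))        ≡⟨ cong (2 *_) (C-absorb (k + k) k) ⟩
  2 * (suc (k + k) * central k)              ∎
  where
  open ≡-Reasoning
  swap : ∀ a b → a * (2 * b) ≡ 2 * (a * b)
  swap = solve-∀

-- The sharpened Wallis bound C(2k,k) ≤ 4ᵏ/√(3k+1): along the recurrence the
-- left side grows by 4(2k+1)²(3k+4)/((k+1)²(3k+1)) ≤ 16 per step.
central²-bound : ∀ k → central k * central k * (3 * k + 1) ≤ 16 ^ k
central²-bound zero    = s≤s z≤n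
central²-bound (suc k) = *-cancelˡ-≤ (suc k * suc k) (begin
  suc k * suc k * (c′ * c′ * (3 * suc k + 1))              ≡⟨ e₁ k c′ ⟩
  (suc k * c′) * (suc k * c′) * (3 * k + 4)                ≡⟨ cong (λ x → x * x * (3 * k + 4)) (central-recurrence k) ⟩
  (2 * (suc (k + k) * c)) * (2 * (suc (k + k) * c)) * (3 * k + 4)
                                                           ≡⟨ e₂ k c ⟩
  4 * (suc (k + k) * suc (k + k) * (3 * k + 4)) * (c * c)  ≤⟨ *-monoˡ-≤ (c * c) (*-monoʳ-≤ 4 step-ratio) ⟩
  4 * (4 * (suc k * suc k * (3 * k + 1))) * (c * c)        ≡⟨ e₃ k c ⟩
  suc k * suc k * (16 * (c * c * (3 * k + 1)))             ≤⟨ *-monoʳ-≤ (suc k * suc k) (*-monoʳ-≤ 16 (central²-bound k)) ⟩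
  suc k * suc k * 16 ^ suc k                               ∎)
  where
  open ≤-Reasoning
  c = central k
  c′ = central (suc k)
  step-ratio : suc (k + k) * suc (k + k) * (3 * k + 4) ≤ 4 * (suc k * suc k * (3 * k + 1))
  step-ratio = subst (suc (k + k) * suc (k + k) * (3 * k + 4) ≤_) (poly k) (m≤m+n _ k)
    where
    poly : ∀ k → suc (k + k) * suc (k + k) * (3 * k + 4) + k ≡ 4 * (suc k * suc k * (3 * k + 1))
    poly = solve-∀
  e₁ : ∀ k c′ → suc k * suc k * (c′ * c′ * (3 * suc k + 1)) ≡ (suc k * c′) * (suc k * c′) * (3 * k + 4)
  e₁ = solve-∀
  e₂ : ∀ k c → (2 * (suc (k + k) * c)) * (2 * (suc (k + k) * c)) * (3 * k + 4) ≡
               4 * (suc (k + k) * suc (k + k) * (3 * k + 4)) * (c * c)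
  e₂ = solve-∀
  e₃ : ∀ k c → 4 * (4 * (suc k * suc k * (3 * k + 1))) * (c * c) ≡ suc k * suc k * (16 * (c * c * (3 * k + 1)))
  e₃ = solve-∀

16^k≡4^[k+k] : ∀ k → 16 ^ k ≡ 4 ^ (k + k)
16^k≡4^[k+k] k = trans (^-*-assoc 4 2 k) (cong (λ e → 4 ^ (k + e)) (+-identityʳ k))

4^n≡2^n*2^n : ∀ n → 4 ^ n ≡ 2 ^ n * 2 ^ n
4^n≡2^n*2^n n = trans (^-*-assoc 2 2 n) (trans (cong (λ e → 2 ^ (n + e)) (+-identityʳ n)) (^-distribˡ-+-* 2 n n))

^-distribʳ-* : ∀ m n o → (m * n) ^ o ≡ m ^ o * n ^ o
^-distribʳ-* m n zero    = refl
^-distribʳ-* m n (suc o) = trans (cong (m * n *_) (^-distribʳ-* m n o)) (interchange m n (m ^ o) (n ^ o))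
  where
  interchange : ∀ a b c d → a * b * (c * d) ≡ a * c * (b * d)
  interchange = solve-∀

middle²-bound-even : ∀ h → central h * central h * (3 * (h + h) + 2) ≤ 2 * 4 ^ (h + h)
middle²-bound-even h = begin
  c * c * (3 * (h + h) + 2)  ≡⟨ double c h ⟩
  2 * (c * c * (3 * h + 1))  ≤⟨ *-monoʳ-≤ 2 (central²-bound h) ⟩
  2 * 16 ^ h                 ≡⟨ cong (2 *_) (16^k≡4^[k+k] h) ⟩
  2 * 4 ^ (h + h)            ∎
  where
  open ≤-Reasoning
  c = central h
  double : ∀ c h → c * c * (3 * (h + h) + 2) ≡ 2 * (c * c * (3 * h + 1))
  double = solve-∀

-- Here 2·C(2h+1,h) = C(2h+2,h+1), so the odd case reduces to the even bound at h+1.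
middle²-bound-odd : ∀ h → let d = suc (h + h) C h in d * d * (3 * suc (h + h) + 2) ≤ 2 * 4 ^ suc (h + h)
middle²-bound-odd h = *-cancelˡ-≤ 2 (begin
  2 * (d * d * (3 * suc (h + h) + 2))            ≤⟨ *-monoʳ-≤ 2 (*-monoʳ-≤ (d * d) (m≤m+n _ 3)) ⟩
  2 * (d * d * (3 * suc (h + h) + 2 + 3))        ≡⟨ e₁ d h ⟩
  (2 * d) * (2 * d) * (3 * suc h + 1)            ≡⟨ cong (λ x → x * x * (3 * suc h + 1)) (central-suc h) ⟨
  central (suc h) * central (suc h) * (3 * suc h + 1) ≤⟨ central²-bound (suc h) ⟩
  16 ^ suc h                                     ≡⟨ 16^k≡4^[k+k] (suc h) ⟩
  4 ^ (suc h + suc h)                            ≡⟨ cong (4 ^_) (cong suc (+-suc h h)) ⟩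
  4 * (4 * 4 ^ (h + h))                          ≡⟨ e₂ (4 ^ (h + h)) ⟩
  2 * (2 * 4 ^ suc (h + h))                      ∎)
  where
  open ≤-Reasoning
  d = suc (h + h) C h
  e₁ : ∀ d h → 2 * (d * d * (3 * suc (h + h) + 2 + 3)) ≡ (2 * d) * (2 * d) * (3 * suc h + 1)
  e₁ = solve-∀
  e₂ : ∀ x → 4 * (4 * x) ≡ 2 * (2 * (4 * x))
  e₂ = solve-∀

middle²-bound : ∀ n → let c = n C ⌊ n /2⌋ in c * c * (3 * n + 2) ≤ 2 * 4 ^ n
middle²-bound n with ⌊n/2⌋-parity n
... | inj₁ even = subst (λ x → (x C ⌊ n /2⌋) * (x C ⌊ n /2⌋) * (3 * x + 2) ≤ 2 * 4 ^ x) (sym even) (middle²-bound-even ⌊ n /2⌋)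
... | inj₂ odd  = subst (λ x → (x C ⌊ n /2⌋) * (x C ⌊ n /2⌋) * (3 * x + 2) ≤ 2 * 4 ^ x) (sym odd) (middle²-bound-odd ⌊ n /2⌋)

C≤2^ : ∀ n k → n C k ≤ 2 ^ n
C≤2^ n       zero    = m^n>0 2 n
C≤2^ zero    (suc k) = z≤n
C≤2^ (suc n) (suc k) = begin
  suc n C suc k          ≡⟨ pascal n k ⟩
  n C k + n C suc k      ≤⟨ +-mono-≤ (C≤2^ n k) (C≤2^ n (suc k)) ⟩
  2 ^ n + 2 ^ n          ≡⟨ cong (_+_ (2 ^ n)) (+-identityʳ (2 ^ n)) ⟨
  2 ^ suc n              ∎
  where open ≤-Reasoning

^≤!*C : ∀ y j → y ^ j ≤ j ! * ((y + j) C j)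
^≤!*C y zero    = s≤s z≤n
^≤!*C y (suc j) = begin
  y * y ^ j                                   ≤⟨ *-mono-≤ (≤-trans (m≤m+n y j) (n≤1+n (y + j))) (^≤!*C y j) ⟩
  suc (y + j) * (j ! * ((y + j) C j))         ≡⟨ e₁ (suc (y + j)) (j !) ((y + j) C j) ⟩
  j ! * (suc (y + j) * ((y + j) C j))         ≡⟨ cong (j ! *_) (C-absorb (y + j) j) ⟨
  j ! * (suc j * (suc (y + j) C suc j))       ≡⟨ e₂ (j !) (suc j) (suc (y + j) C suc j) ⟩
  (suc j * j !) * (suc (y + j) C suc j)       ≡⟨ cong (λ z → (suc j * j !) * (z C suc j)) (+-suc y j) ⟨
  suc j ! * ((y + suc j) C suc j)             ∎
  where
  open ≤-Reasoning
  e₁ : ∀ a b c → a * (b * c) ≡ b * (a * c)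
  e₁ = solve-∀
  e₂ : ∀ a b c → a * (b * c) ≡ (b * a) * c
  e₂ = solve-∀

-- One row of a resampled block

m*m≤n*n⇒m≤n : ∀ {m n} → m * m ≤ n * n → m ≤ n
m*m≤n*n⇒m≤n m²≤n² = ≮⇒≥ (λ n<m → <⇒≱ (*-mono-< n<m n<m) m²≤n²)

m*m<n*n⇒m<n : ∀ {m n} → m * m < n * n → m < n
m*m<n*n⇒m<n m²<n² = ≰⇒> (λ n≤m → <⇒≱ m²<n² (*-mono-≤ n≤m n≤m))

dot : ∀ {c} → SignVec c → SignVec c → ℤ
dot {c} b τ = sumFin c (λ k → sgn (b k) ℤ.* sgn (τ k))

agreements : ∀ {c} → SignVec c → SignVec c → ℕ
agreements {zero}  b τ = 0
agreements {suc c} b τ = if b zero == τ zero then suc rest else rest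
  where rest = agreements (b ∘ suc) (τ ∘ suc)

dot≡2agreements-c : ∀ {c} (b τ : SignVec c) → dot b τ ≡ + (agreements b τ + agreements b τ) ℤ.- + c
dot≡2agreements-c {zero}  b τ = refl
dot≡2agreements-c {suc c} b τ
  rewrite sumFin-suc c (λ k → sgn (b k) ℤ.* sgn (τ k)) | dot≡2agreements-c (b ∘ suc) (τ ∘ suc) =
  step (b zero) (τ zero)
  where
  r = agreements (b ∘ suc) (τ ∘ suc)
  agree : ∀ x y → + 1 ℤ.+ ((x ℤ.+ x) ℤ.- y) ≡ ((+ 1 ℤ.+ x) ℤ.+ (+ 1 ℤ.+ x)) ℤ.- (+ 1 ℤ.+ y)
  agree = ℤSolver.solve-∀
  disagree : ∀ x y → ℤ.-[1+ 0 ] ℤ.+ ((x ℤ.+ x) ℤ.- y) ≡ (x ℤ.+ x) ℤ.- (+ 1 ℤ.+ y)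
  disagree = ℤSolver.solve-∀
  step : ∀ x y → let a = if x == y then suc r else r in
         sgn x ℤ.* sgn y ℤ.+ (+ (r + r) ℤ.- + c) ≡ + (a + a) ℤ.- + suc c
  step true  true  = agree (+ r) (+ c)
  step false false = agree (+ r) (+ c)
  step true  false = disagree (+ r) (+ c)
  step false true  = disagree (+ r) (+ c)

count-agreements≡C : ∀ c (τ : SignVec c) j → count (λ b → agreements b τ ≡ᵇ j) (allFuns bools c) ≡ c C j
count-agreements≡C zero    τ zero    = refl
count-agreements≡C zero    τ (suc j) = refl
count-agreements≡C (suc c) τ j = begin
  count p (allFuns bools (suc c))
    ≡⟨ count-concatMap p (λ x → map (x Vector.∷_) L) bools ⟩
  count p (map (true Vector.∷_) L) + (count p (map (false Vector.∷_) L) + 0)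
    ≡⟨ cong₂ (λ a b → a + (b + 0)) (count-map p (true Vector.∷_) L) (count-map p (false Vector.∷_) L) ⟩
  count (p ∘ (true Vector.∷_)) L + (count (p ∘ (false Vector.∷_)) L + 0)
    ≡⟨ by-first-sign (τ zero) j ⟩
  suc c C j ∎
  where
  open ≡-Reasoning
  L = allFuns bools c
  p : SignVec (suc c) → Bool
  p b = agreements b τ ≡ᵇ j
  rest : SignVec c → ℕ
  rest b = agreements b (τ ∘ suc)
  IH : ∀ j → count (λ b → rest b ≡ᵇ j) L ≡ c C j
  IH = count-agreements≡C c (τ ∘ suc)
  by-first-sign : ∀ t j →
    count (λ b → (if true == t then suc (rest b) else rest b) ≡ᵇ j) L +
    (count (λ b → (if false == t then suc (rest b) else rest b) ≡ᵇ j) L + 0) ≡ suc c C j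
  by-first-sign true  zero    = cong₂ (λ a b → a + (b + 0)) (count-const-false L) (IH 0)
  by-first-sign false zero    = cong₂ (λ a b → a + (b + 0)) (IH 0) (count-const-false L)
  by-first-sign true  (suc j) = begin
    count (λ b → rest b ≡ᵇ j) L + (count (λ b → rest b ≡ᵇ suc j) L + 0) ≡⟨ cong₂ (λ a b → a + (b + 0)) (IH j) (IH (suc j)) ⟩
    c C j + (c C suc j + 0)                                         ≡⟨ cong (_+_ (c C j)) (+-identityʳ _) ⟩
    c C j + c C suc j                                               ≡⟨ pascal c j ⟨
    suc c C suc j                                                   ∎
  by-first-sign false (suc j) = begin
    count (λ b → rest b ≡ᵇ suc j) L + (count (λ b → rest b ≡ᵇ j) L + 0) ≡⟨ cong₂ (λ a b → a + (b + 0)) (IH (suc j)) (IH j) ⟩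
    c C suc j + (c C j + 0)                                         ≡⟨ cong (_+_ (c C suc j)) (+-identityʳ _) ⟩
    c C suc j + c C j                                               ≡⟨ +-comm (c C suc j) (c C j) ⟩
    c C j + c C suc j                                               ≡⟨ pascal c j ⟨
    suc c C suc j                                                   ∎

count-applyUpTo-suc : ∀ (P : ℕ → Bool) N → count P (applyUpTo suc N) ≡ count (P ∘ suc) (upTo N)
count-applyUpTo-suc P N = trans (cong (count P) (sym (List.map-applyUpTo id suc N))) (count-map P suc (upTo N))

count-upTo-below : ∀ N L (P : ℕ → Bool) → (∀ j → T (P j) → j < L) → count P (upTo N) ≤ L
count-upTo-below zero    L       P below = z≤n
count-upTo-below (suc N) L       P below with P 0 | below 0
count-upTo-below (suc N) zero    P below | true  | 0<0 = contradiction (0<0 _) (λ ())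
count-upTo-below (suc N) (suc L) P below | true  | _   = s≤s (begin
  count P (applyUpTo suc N)  ≡⟨ count-applyUpTo-suc P N ⟩
  count (P ∘ suc) (upTo N)   ≤⟨ count-upTo-below N L (P ∘ suc) (λ j pj → s<s⁻¹ (below (suc j) pj)) ⟩
  L                          ∎)
  where open ≤-Reasoning
count-upTo-below (suc N) L       P below | false | _   = begin
  count P (applyUpTo suc N)  ≡⟨ count-applyUpTo-suc P N ⟩
  count (P ∘ suc) (upTo N)   ≤⟨ count-upTo-below N L (P ∘ suc) (λ j pj → ≤-trans (n≤1+n _) (below (suc j) pj)) ⟩
  L                          ∎
  where open ≤-Reasoning

count-upTo-window : ∀ N D (P : ℕ → Bool) → (∀ j k → T (P j) → T (P k) → k ≤ j + D) → count P (upTo N) ≤ suc D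
count-upTo-window zero    D P window = z≤n
count-upTo-window (suc N) D P window with P 0 | window 0
... | true  | window₀ = s≤s (begin
  count P (applyUpTo suc N)  ≡⟨ count-applyUpTo-suc P N ⟩
  count (P ∘ suc) (upTo N)   ≤⟨ count-upTo-below N D (P ∘ suc) (λ k pk → window₀ (suc k) _ pk) ⟩
  D                          ∎)
  where open ≤-Reasoning
... | false | _ = begin
  count P (applyUpTo suc N)  ≡⟨ count-applyUpTo-suc P N ⟩
  count (P ∘ suc) (upTo N)   ≤⟨ count-upTo-window N D (P ∘ suc) (λ j k pj pk → s≤s⁻¹ (window (suc j) (suc k) pj pk)) ⟩
  suc D                      ∎
  where open ≤-Reasoning

m+m≤n+n⇒m≤n : ∀ {m n} → m + m ≤ n + n → m ≤ n
m+m≤n+n⇒m≤n 2m≤2n = ≮⇒≥ (λ n<m → <⇒≱ (+-mono-< n<m n<m) 2m≤2n)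

∣∣≤-window : ∀ (s : ℤ) c D j k → ∣ s ℤ.+ (+ (j + j) ℤ.- + c) ∣ ≤ D → ∣ s ℤ.+ (+ (k + k) ℤ.- + c) ∣ ≤ D →
             k ≤ j + D
∣∣≤-window s c D j k ∣vⱼ∣≤D ∣vₖ∣≤D with ≤-total j k
... | inj₂ k≤j = ≤-trans k≤j (m≤m+n j D)
... | inj₁ j≤k = m+m≤n+n⇒m≤n (begin
  k + k                             ≡⟨ m+[n∸m]≡n 2j≤2k ⟨
  (j + j) + ((k + k) ∸ (j + j))     ≤⟨ +-monoʳ-≤ (j + j) (subst (_≤ D + D) ∣vₖ-vⱼ∣≡2k-2j ∣vₖ-vⱼ∣≤2D) ⟩
  (j + j) + (D + D)                 ≡⟨ shuffle j D ⟩
  (j + D) + (j + D)                 ∎)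
  where
  open ≤-Reasoning
  vⱼ = s ℤ.+ (+ (j + j) ℤ.- + c)
  vₖ = s ℤ.+ (+ (k + k) ℤ.- + c)
  2j≤2k : j + j ≤ k + k
  2j≤2k = +-mono-≤ j≤k j≤k
  ∣vₖ-vⱼ∣≤2D : ∣ vₖ ℤ.- vⱼ ∣ ≤ D + D
  ∣vₖ-vⱼ∣≤2D = ≤-trans (ℤProp.∣i-j∣≤∣i∣+∣j∣ vₖ vⱼ) (+-mono-≤ ∣vₖ∣≤D ∣vⱼ∣≤D)
  cancel-s : ∀ s a b c → (s ℤ.+ (a ℤ.- c)) ℤ.- (s ℤ.+ (b ℤ.- c)) ≡ a ℤ.- b
  cancel-s = ℤSolver.solve-∀
  ∣vₖ-vⱼ∣≡2k-2j : ∣ vₖ ℤ.- vⱼ ∣ ≡ (k + k) ∸ (j + j)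
  ∣vₖ-vⱼ∣≡2k-2j = cong ∣_∣ (trans (cancel-s s (+ (k + k)) (+ (j + j)) (+ c))
                           (trans (ℤProp.m-n≡m⊖n (k + k) (j + j)) (ℤProp.⊖-≥ 2j≤2k)))
  shuffle : ∀ j D → (j + j) + (D + D) ≡ (j + D) + (j + D)
  shuffle = solve-∀

small : ℕ → ℤ → Bool
small M v = (24 * ∣ v ∣) ^ 2 ≤ᵇ M

small⇒∣∣≤ : ∀ {M D} v → M < 576 * suc D * suc D → T (small M v) → ∣ v ∣ ≤ D
small⇒∣∣≤ {M} {D} v M<[24D+24]² small-v = s≤s⁻¹ (*-cancelˡ-< 24 ∣ v ∣ (suc D) (m*m<n*n⇒m<n (begin-strict
  24 * ∣ v ∣ * (24 * ∣ v ∣)        ≡⟨ cong (24 * ∣ v ∣ *_) (*-identityʳ (24 * ∣ v ∣)) ⟨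
  (24 * ∣ v ∣) ^ 2                 ≤⟨ ≤ᵇ⇒≤ _ M small-v ⟩
  M                                <⟨ M<[24D+24]² ⟩
  576 * suc D * suc D              ≡⟨ square (suc D) ⟩
  24 * suc D * (24 * suc D)        ∎)))
  where
  open ≤-Reasoning
  square : ∀ d → 576 * d * d ≡ 24 * d * (24 * d)
  square = solve-∀

⌊√_/24⌋ : ∀ M → Σ ℕ (λ D → 576 * D * D ≤ M × M < 576 * suc D * suc D)
⌊√ zero /24⌋ = 0 , z≤n , s≤s z≤n
⌊√ suc M /24⌋ with ⌊√ M /24⌋
... | D , lo , hi with ≤-<-connex (576 * suc D * suc D) (suc M)
...   | inj₂ M<  = D , m≤n⇒m≤1+n lo , M<
...   | inj₁ ≤M  = suc D , ≤M , subst (_< 576 * suc (suc D) * suc (suc D)) (≤-antisym ≤M hi) grows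
  where
  grows : 576 * suc D * suc D < 576 * suc (suc D) * suc (suc D)
  grows = *-mono-< (*-monoʳ-< 576 (n<1+n (suc D))) (n<1+n (suc D))

576[D+1]²≤2M+1152 : ∀ M D → 576 * D * D ≤ M → 576 * suc D * suc D ≤ 2 * M + 1152
576[D+1]²≤2M+1152 M zero    _    = ≤-trans (m≤m+n 576 576) (m≤n+m 1152 (2 * M))
576[D+1]²≤2M+1152 M (suc D) 576D²≤M = begin
  576 * suc (suc D) * suc (suc D)                     ≤⟨ m≤m+n _ (576 * D * D) ⟩
  576 * suc (suc D) * suc (suc D) + 576 * D * D       ≡⟨ parallelogram D ⟩
  2 * (576 * suc D * suc D) + 1152                    ≤⟨ +-monoˡ-≤ 1152 (*-monoʳ-≤ 2 576D²≤M) ⟩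
  2 * M + 1152                                        ∎
  where
  open ≤-Reasoning
  parallelogram : ∀ D → 576 * suc (suc D) * suc (suc D) + 576 * D * D ≡ 2 * (576 * suc D * suc D) + 1152
  parallelogram = solve-∀

-- This is where M₀ = 837 comes from: the inequality fails for M = 836.
256[2M+1152]≤288[3M+2] : ∀ M → 837 ≤ M → 256 * (2 * M + 1152) ≤ 288 * (3 * M + 2)
256[2M+1152]≤288[3M+2] M 837≤M = begin
  256 * (2 * M + 1152)        ≡⟨ lhs M ⟩
  512 * M + 294912            ≤⟨ +-monoʳ-≤ (512 * M) (≤ᵇ⇒≤ 294912 (352 * 837 + 576) _) ⟩
  512 * M + (352 * 837 + 576) ≤⟨ +-monoʳ-≤ (512 * M) (+-monoˡ-≤ 576 (*-monoʳ-≤ 352 837≤M)) ⟩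
  512 * M + (352 * M + 576)   ≡⟨ rhs M ⟨
  288 * (3 * M + 2)           ∎
  where
  open ≤-Reasoning
  lhs : ∀ M → 256 * (2 * M + 1152) ≡ 512 * M + 294912
  lhs = solve-∀
  rhs : ∀ M → 288 * (3 * M + 2) ≡ 512 * M + (352 * M + 576)
  rhs = solve-∀

16[D+1]C≤2^M : ∀ M D → 837 ≤ M → 576 * D * D ≤ M → 16 * (suc D * (M C ⌊ M /2⌋)) ≤ 2 ^ M
16[D+1]C≤2^M M D 837≤M 576D²≤M = m*m≤n*n⇒m≤n (*-cancelˡ-≤ 576 (begin
  576 * (X * X)                            ≡⟨ e₁ (suc D) c ⟩
  256 * (576 * suc D * suc D) * (c * c)    ≤⟨ *-monoˡ-≤ (c * c) (*-monoʳ-≤ 256 (576[D+1]²≤2M+1152 M D 576D²≤M)) ⟩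
  256 * (2 * M + 1152) * (c * c)           ≤⟨ *-monoˡ-≤ (c * c) (256[2M+1152]≤288[3M+2] M 837≤M) ⟩
  288 * (3 * M + 2) * (c * c)              ≡⟨ e₂ c M ⟩
  288 * (c * c * (3 * M + 2))              ≤⟨ *-monoʳ-≤ 288 (middle²-bound M) ⟩
  288 * (2 * 4 ^ M)                        ≡⟨ e₃ (4 ^ M) ⟩
  576 * 4 ^ M                              ≡⟨ cong (576 *_) (4^n≡2^n*2^n M) ⟩
  576 * (2 ^ M * 2 ^ M)                    ∎))
  where
  open ≤-Reasoning
  c = M C ⌊ M /2⌋
  X = 16 * (suc D * c)
  e₁ : ∀ d c → 576 * (16 * (d * c) * (16 * (d * c))) ≡ 256 * (576 * d * d) * (c * c)
  e₁ = solve-∀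
  e₂ : ∀ c M → 288 * (3 * M + 2) * (c * c) ≡ 288 * (c * c * (3 * M + 2))
  e₂ = solve-∀
  e₃ : ∀ y → 288 * (2 * y) ≡ 576 * y
  e₃ = solve-∀

agreements≤ : ∀ {c} (b τ : SignVec c) → agreements b τ ≤ c
agreements≤ {zero}  b τ = z≤n
agreements≤ {suc c} b τ with b zero == τ zero
... | true  = s≤s (agreements≤ (b ∘ suc) (τ ∘ suc))
... | false = m≤n⇒m≤1+n (agreements≤ (b ∘ suc) (τ ∘ suc))

16*count-small≤2^ : ∀ M → 837 ≤ M → ∀ (s : ℤ) (τ : SignVec M) →
                    16 * count (λ b → small M (s ℤ.+ dot b τ)) (allFuns bools M) ≤ 2 ^ M
16*count-small≤2^ M 837≤M s τ with ⌊√ M /24⌋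
... | D , 576D²≤M , M<576[D+1]² = ≤-trans (*-monoʳ-≤ 16 (begin
  count (λ b → small M (s ℤ.+ dot b τ)) Bs
    ≡⟨ count-cong (λ b → cong (small M ∘ ℤ._+_ s) (dot≡2agreements-c b τ)) Bs ⟩
  count (Q ∘ agr) Bs
    ≤⟨ count-mono (λ b → agr∈W b ∘ Equivalence.to T-≡) Bs ⟩
  count (λ b → any (λ j → agr b ≡ᵇ j) W) Bs
    ≤⟨ count-any≤sum (λ b j → agr b ≡ᵇ j) W Bs ⟩
  sum (map (λ j → count (λ b → agr b ≡ᵇ j) Bs) W)
    ≡⟨ cong sum (List.map-cong (count-agreements≡C M τ) W) ⟩
  sum (map (M C_) W)
    ≡⟨ *-identityˡ _ ⟨
  1 * sum (map (M C_) W)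
    ≤⟨ *-sum≤length* 1 (M C_) (λ j → ≤-trans (≤-reflexive (*-identityˡ _)) (C≤C-middle M j)) W ⟩
  count Q (upTo (suc M)) * (M C ⌊ M /2⌋)
    ≤⟨ *-monoˡ-≤ (M C ⌊ M /2⌋) (count-upTo-window (suc M) D Q window) ⟩
  suc D * (M C ⌊ M /2⌋) ∎)) (16[D+1]C≤2^M M D 837≤M 576D²≤M)
  where
  open ≤-Reasoning
  Bs = allFuns bools M
  agr : SignVec M → ℕ
  agr b = agreements b τ
  v : ℕ → ℤ
  v j = s ℤ.+ (+ (j + j) ℤ.- + M)
  Q : ℕ → Bool
  Q j = small M (v j)
  W = filter (λ j → Q j ≟ᵇ true) (upTo (suc M))
  agr∈W : ∀ b → Q (agr b) ≡ true → T (any (λ j → agr b ≡ᵇ j) W)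
  agr∈W b Q-agr = any⁺ (λ j → agr b ≡ᵇ j)
    (lose (∈-filter⁺ (λ j → Q j ≟ᵇ true) (∈-upTo⁺ (s≤s (agreements≤ b τ))) Q-agr) (≡⇒≡ᵇ (agr b) (agr b) refl))
  window : ∀ j k → T (Q j) → T (Q k) → k ≤ j + D
  window j k Qj Qk = ∣∣≤-window s M D j k (small⇒∣∣≤ (v j) M<576[D+1]² Qj) (small⇒∣∣≤ (v k) M<576[D+1]² Qk)

-- Rationals and the exponential series

toℚᵘ-/ : ∀ i n .{{_ : NonZero n}} → toℚᵘ (i / n) ℚᵘ.≃ (i ℚᵘ./ n)
toℚᵘ-/ i (suc n) = ℚProp.toℚᵘ-fromℚᵘ (mkℚᵘ i n)

+m/n≤+o/p : ∀ m n o p .{{_ : NonZero n}} .{{_ : NonZero p}} → m * p ℕ.≤ o * n → + m / n ℚ.≤ + o / p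
+m/n≤+o/p m n o p mp≤on = ℚProp.toℚᵘ-cancel-≤
  (ℚᵘProp.≤-respˡ-≃ (ℚᵘProp.≃-sym (toℚᵘ-/ (+ m) n)) (ℚᵘProp.≤-respʳ-≃ (ℚᵘProp.≃-sym (toℚᵘ-/ (+ o) p)) (unnormalised n p mp≤on)))
  where
  unnormalised : ∀ n p .{{_ : NonZero n}} .{{_ : NonZero p}} → m * p ℕ.≤ o * n → + m ℚᵘ./ n ℚᵘ.≤ + o ℚᵘ./ p
  unnormalised (suc n) (suc p) mp≤on = *≤* (subst₂ ℤ._≤_ (ℤProp.pos-* m (suc p)) (ℤProp.pos-* o (suc n)) (+≤+ mp≤on))

+m/n++o/n : ∀ m o n .{{_ : NonZero n}} → + m / n ℚ.+ + o / n ≡ + (m + o) / n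
+m/n++o/n m o n = ℚProp.toℚᵘ-injective (ℚᵘProp.≃-trans (ℚProp.toℚᵘ-homo-+ (+ m / n) (+ o / n))
  (ℚᵘProp.≃-trans (ℚᵘProp.+-cong (toℚᵘ-/ (+ m) n) (toℚᵘ-/ (+ o) n))
    (ℚᵘProp.≃-sym (ℚᵘProp.≃-trans (toℚᵘ-/ (+ (m + o)) n) (unnormalised n)))))
  where
  unnormalised : ∀ n .{{_ : NonZero n}} → + (m + o) ℚᵘ./ n ℚᵘ.≃ (+ m ℚᵘ./ n ℚᵘ.+ + o ℚᵘ./ n)
  unnormalised (suc n) = *≡* (begin
    + (m + o) ℤ.* + (s * s)              ≡⟨ ℤProp.pos-* (m + o) (s * s) ⟨
    + ((m + o) * (s * s))                ≡⟨ cong +_ (e m o s) ⟩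
    + ((m * s + o * s) * s)              ≡⟨ ℤProp.pos-* (m * s + o * s) s ⟩
    + (m * s + o * s) ℤ.* + s            ≡⟨ cong (ℤ._* + s) (ℤProp.pos-+ (m * s) (o * s)) ⟩
    (+ (m * s) ℤ.+ + (o * s)) ℤ.* + s    ≡⟨ cong (ℤ._* + s) (cong₂ ℤ._+_ (ℤProp.pos-* m s) (ℤProp.pos-* o s)) ⟩
    (+ m ℤ.* + s ℤ.+ + o ℤ.* + s) ℤ.* + s ∎)
    where
    open ≡-Reasoning
    s = suc n
    e : ∀ m o s → (m + o) * (s * s) ≡ (m * s + o * s) * s
    e = solve-∀

+m/n*+o/p : ∀ m n o p .{{_ : NonZero n}} .{{_ : NonZero p}} →
            + m / n ℚ.* (+ o / p) ≡ (+ (m * o) / (n * p)) {{m*n≢0 n p}}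
+m/n*+o/p m n o p = ℚProp.toℚᵘ-injective (ℚᵘProp.≃-trans (ℚProp.toℚᵘ-homo-* (+ m / n) (+ o / p))
  (ℚᵘProp.≃-trans (ℚᵘProp.*-cong (toℚᵘ-/ (+ m) n) (toℚᵘ-/ (+ o) p))
    (ℚᵘProp.≃-sym (ℚᵘProp.≃-trans (toℚᵘ-/ (+ (m * o)) (n * p) {{m*n≢0 n p}}) (unnormalised n p)))))
  where
  unnormalised : ∀ n p .{{_ : NonZero n}} .{{_ : NonZero p}} →
                 (+ (m * o) ℚᵘ./ (n * p)) {{m*n≢0 n p}} ℚᵘ.≃ ((+ m ℚᵘ./ n) ℚᵘ.* (+ o ℚᵘ./ p))
  unnormalised (suc n) (suc p) = *≡* (cong (ℤ._* + (suc n * suc p)) (ℤProp.pos-* m o))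

n^j*2^j≤16^n*j! : ∀ n j → n ^ j * 2 ^ j ℕ.≤ 16 ^ n * j !
n^j*2^j≤16^n*j! n j = *-cancelʳ-≤ _ _ (2 ^ j) {{m^n≢0 2 j}} (begin
  n ^ j * 2 ^ j * 2 ^ j         ≡⟨ e₁ (n ^ j) (2 ^ j) ⟩
  (2 ^ j * 2 ^ j) * n ^ j       ≡⟨ cong (_* n ^ j) (4^n≡2^n*2^n j) ⟨
  4 ^ j * n ^ j                 ≡⟨ ^-distribʳ-* 4 n j ⟨
  (4 * n) ^ j                   ≤⟨ ^≤!*C (4 * n) j ⟩
  j ! * ((4 * n + j) C j)       ≤⟨ *-monoʳ-≤ (j !) (C≤2^ (4 * n + j) j) ⟩
  j ! * 2 ^ (4 * n + j)         ≡⟨ cong (j ! *_) (^-distribˡ-+-* 2 (4 * n) j) ⟩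
  j ! * (2 ^ (4 * n) * 2 ^ j)   ≡⟨ cong (λ x → j ! * (x * 2 ^ j)) (^-*-assoc 2 4 n) ⟨
  j ! * (16 ^ n * 2 ^ j)        ≡⟨ e₂ (j !) (16 ^ n) (2 ^ j) ⟩
  16 ^ n * j ! * 2 ^ j          ∎)
  where
  open ≤-Reasoning
  e₁ : ∀ a b → a * b * b ≡ (b * b) * a
  e₁ = solve-∀
  e₂ : ∀ a b c → a * (b * c) ≡ b * a * c
  e₂ = solve-∀

foldr-+-≤-halving : ∀ (t u : ℕ → ℚ) (f : ℕ → ℕ) l → (∀ i → t (f i) ℚ.≤ u i) →
  (∀ i → u (suc i) ℚ.+ u (suc i) ℚ.≤ u i) → (∀ i → 0ℚ ℚ.≤ u i) →
  foldr (λ j acc → t j ℚ.+ acc) 0ℚ (applyUpTo f l) ℚ.≤ u 0 ℚ.+ u 0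
foldr-+-≤-halving t u f zero    t≤u halving u≥0 = ℚProp.+-mono-≤ (u≥0 0) (u≥0 0)
foldr-+-≤-halving t u f (suc l) t≤u halving u≥0 = ℚProp.+-mono-≤ (t≤u 0)
  (ℚProp.≤-trans (foldr-+-≤-halving t (u ∘ suc) (f ∘ suc) l (t≤u ∘ suc) (halving ∘ suc) (u≥0 ∘ suc)) (halving 0))

expPartial≤2·16^n : ∀ n k → expPartial n k ℚ.≤ + (16 ^ n + 16 ^ n) / 1
expPartial≤2·16^n n k = ℚProp.≤-trans
  (foldr-+-≤-halving (λ j → (+ (n ^ j) / j !) {{j !≢0}}) u id (suc k) term≤u halving u≥0)
  (ℚProp.≤-reflexive (+m/n++o/n (16 ^ n) (16 ^ n) 1))
  where
  u : ℕ → ℚ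
  u i = (+ (16 ^ n) / 2 ^ i) {{m^n≢0 2 i}}
  term≤u : ∀ i → (+ (n ^ i) / i !) {{i !≢0}} ℚ.≤ u i
  term≤u i = +m/n≤+o/p (n ^ i) (i !) (16 ^ n) (2 ^ i) {{i !≢0}} {{m^n≢0 2 i}} (n^j*2^j≤16^n*j! n i)
  halving : ∀ i → u (suc i) ℚ.+ u (suc i) ℚ.≤ u i
  halving i = ℚProp.≤-trans (ℚProp.≤-reflexive (+m/n++o/n (16 ^ n) (16 ^ n) (2 ^ suc i) {{m^n≢0 2 (suc i)}}))
    (+m/n≤+o/p (16 ^ n + 16 ^ n) (2 ^ suc i) (16 ^ n) (2 ^ i) {{m^n≢0 2 (suc i)}} {{m^n≢0 2 i}}
      (≤-reflexive (e (16 ^ n) (2 ^ i))))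
    where
    e : ∀ x p → (x + x) * p ≡ x * (2 * p)
    e = solve-∀
  u≥0 : ∀ i → 0ℚ ℚ.≤ u i
  u≥0 i = +m/n≤+o/p 0 1 (16 ^ n) (2 ^ i) {{_}} {{m^n≢0 2 i}} z≤n

-- Candidate solutions

-- A solution of Ξ is determined by its common first n - M coordinates and the
-- last M coordinates of each σᵢ.
Candidate : ℕ → ℕ → ℕ → Set
Candidate M a m = SignVec a × (Fin m → SignVec M)

candidates : (M a m : ℕ) → List (Candidate M a m)
candidates M a m = cartesianProduct (allFuns bools a) (allFuns (allFuns bools M) m)

solves : ∀ {M a m} → Outcome M a m → Candidate M a m → Bool
solves {M} {a} {m} (base , blocks) (τ₀ , tails) =
  allFinᵇ m (λ i → allFinᵇ M (λ r → small M (dot (base r) τ₀ ℤ.+ dot (blocks i r) (tails i))))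

∈-bools : ∀ x → x ∈ bools
∈-bools true  = here refl
∈-bools false = there (here refl)

==⇒≡ : ∀ {x y} → T (x == y) → x ≡ y
==⇒≡ {true}  {true}  _ = refl
==⇒≡ {false} {false} _ = refl

design-row≡ : ∀ {M a m} (ω : Outcome M a m) i (σ : SignVec (a + M)) (τ₀ : SignVec a) (t : SignVec M) →
  (∀ k → σ (k ↑ˡ M) ≡ τ₀ k) → (∀ k → σ (a ↑ʳ k) ≡ t k) →
  ∀ r → matVec (design ω i) σ r ≡ dot (proj₁ ω r) τ₀ ℤ.+ dot (proj₂ ω i r) t
design-row≡ {M} {a} ω@(base , blocks) i σ τ₀ t σ≡τ₀ σ≡t r = trans (sumFin-+ a M (λ k → sgn (design ω i r k) ℤ.* sgn (σ k)))
  (cong₂ ℤ._+_ (sumFin-cong a (λ k → cong₂ (λ x y → sgn x ℤ.* sgn y) (cong [ base r , blocks i r ]′ (splitAt-↑ˡ a k M)) (σ≡τ₀ k)))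
               (sumFin-cong M (λ k → cong₂ (λ x y → sgn x ℤ.* sgn y) (cong [ base r , blocks i r ]′ (splitAt-↑ʳ a M k)) (σ≡t k))))

inΞ⇒solvable : ∀ {M a m} (ω : Outcome M a m) σ → T (inΞ ω σ) → T (any (solves ω) (candidates M a m))
inΞ⇒solvable {M} {a} {zero} ω σ _ with allFuns-complete _≡_ bools a (λ _ → true) (λ _ → true , ∈-bools true , refl)
... | τ₀ , τ₀∈ , _ = any⁺ (solves ω) (lose (∈-cartesianProduct⁺ τ₀∈ (here {x = λ ()} refl)) _)
inΞ⇒solvable {M} {a} {suc m} ω σ σ∈Ξ =
  any⁺ (solves ω) (lose (∈-cartesianProduct⁺ τ₀∈ tails∈)
    (T-allFinᵇ⁺ (suc m) (λ i → T-allFinᵇ⁺ M (λ r →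
      subst (T ∘ small M) (design-row≡ ω i (σ i) τ₀ (tails i) (shared i) (≡tails i) r) (norms i r)))))
  where
  agree-at : Fin (suc m) → Fin (suc m) → Fin (a + M) → Bool
  agree-at i j k = if (toℕ i <ᵇ toℕ j) ∧ isShared a k then σ i k == σ j k else true
  norms-test agree-test : Bool
  norms-test = allFinᵇ (suc m) (λ i → infNormSmall M (matVec (design ω i) (σ i)))
  agree-test = allFinᵇ (suc m) (λ i → allFinᵇ (suc m) (λ j → allFinᵇ (a + M) (agree-at i j)))
  norms-ok : T norms-test
  norms-ok = proj₁ (Equivalence.to (T-∧ {norms-test} {agree-test}) σ∈Ξ)
  agree-ok : T agree-test
  agree-ok = proj₂ (Equivalence.to (T-∧ {norms-test} {agree-test}) σ∈Ξ)
  norms : ∀ i r → T (small M (matVec (design ω i) (σ i) r))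
  norms i = T-allFinᵇ⁻ M (T-allFinᵇ⁻ (suc m) norms-ok i)
  τ₀-from-σ : SignVec a
  τ₀-from-σ k = σ zero (k ↑ˡ M)
  covered-τ₀ = allFuns-complete _≡_ bools a τ₀-from-σ (λ k → τ₀-from-σ k , ∈-bools _ , refl)
  τ₀ = proj₁ covered-τ₀
  τ₀∈ = proj₁ (proj₂ covered-τ₀)
  covered-tails = allFuns-complete (λ f g → ∀ r → f r ≡ g r) (allFuns bools M) (suc m) (λ i r → σ i (a ↑ʳ r))
    (λ i → allFuns-complete _≡_ bools M (λ r → σ i (a ↑ʳ r)) (λ r → σ i (a ↑ʳ r) , ∈-bools _ , refl))
  tails = proj₁ covered-tails
  tails∈ = proj₁ (proj₂ covered-tails)
  ≡tails = proj₂ (proj₂ covered-tails)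
  shared : ∀ i k → σ i (k ↑ˡ M) ≡ τ₀ k
  shared zero    k = proj₂ (proj₂ covered-τ₀) k
  shared (suc i) k = trans (sym (==⇒≡ agrees)) (proj₂ (proj₂ covered-τ₀) k)
    where
    agrees : T (σ zero (k ↑ˡ M) == σ (suc i) (k ↑ˡ M))
    agrees = subst (λ s → T (if [ (λ _ → true) , (λ _ → false) ]′ s then σ zero (k ↑ˡ M) == σ (suc i) (k ↑ˡ M) else true))
                   (splitAt-↑ˡ a k M)
                   (T-allFinᵇ⁻ (a + M) (T-allFinᵇ⁻ (suc m) (T-allFinᵇ⁻ (suc m) agree-ok zero) (suc i)) (k ↑ˡ M))

count-solves≤ : ∀ M a m → 837 ≤ M → ∀ (p : Candidate M a m) →
                (16 ^ M) ^ m * count (λ ω → solves ω p) (outcomes M a m) ≤ length (outcomes M a m)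
count-solves≤ M a m 837≤M (τ₀ , tails) = begin
  (16 ^ M) ^ m * count (λ ω → solves ω (τ₀ , tails)) (cartesianProduct Bases Blocks)
    ≡⟨ cong ((16 ^ M) ^ m *_) (count-cartesianProduct (λ ω → solves ω (τ₀ , tails)) Bases Blocks) ⟩
  (16 ^ M) ^ m * sum (map (λ base → count (λ blocks → solves (base , blocks) (τ₀ , tails)) Blocks) Bases)
    ≤⟨ *-sum≤length* ((16 ^ M) ^ m) (λ base → count (λ blocks → solves (base , blocks) (τ₀ , tails)) Blocks) per-base Bases ⟩
  length Bases * length Blocks
    ≡⟨ length-cartesianProduct Bases Blocks ⟨
  length (cartesianProduct Bases Blocks) ∎
  where
  open ≤-Reasoning
  Bases = allFuns (allFuns bools a) M
  Blocks = allFuns (allFuns (allFuns bools M) M) m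
  per-base : ∀ base → (16 ^ M) ^ m * count (λ blocks → solves (base , blocks) (τ₀ , tails)) Blocks ≤ length Blocks
  per-base base = count-allFuns-all≤ (allFuns (allFuns bools M) M) m block-ok {16 ^ M} (λ i →
    count-allFuns-all≤ (allFuns bools M) M (row-ok i) {16} (λ r →
      subst (16 * count (row-ok i r) (allFuns bools M) ≤_) (sym (length-allFuns bools M))
            (16*count-small≤2^ M 837≤M (dot (base r) τ₀) (tails i))))
    where
    row-ok : Fin m → Fin M → SignVec M → Bool
    row-ok i r b = small M (dot (base r) τ₀ ℤ.+ dot b (tails i))
    block-ok : Fin m → (Fin M → SignVec M) → Bool
    block-ok i B = allFinᵇ M (λ r → row-ok i r (B r))

T-not-ΞEmpty⇒solvable : ∀ {M a m} (ω : Outcome M a m) → T (not (ΞEmpty ω)) → T (any (solves ω) (candidates M a m))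
T-not-ΞEmpty⇒solvable {M} {a} {m} ω nonempty
  with satisfied (any⁻ (inΞ ω) (allFuns (allFuns bools (a + M)) m) (subst T (not-involutive _) nonempty))
... | σ , σ∈Ξ = inΞ⇒solvable ω σ σ∈Ξ

count-Ξnonempty≤ : ∀ M a m → 837 ≤ M →
  (16 ^ M) ^ m * count (not ∘ ΞEmpty) (outcomes M a m) ≤ length (candidates M a m) * length (outcomes M a m)
count-Ξnonempty≤ M a m 837≤M = begin
  (16 ^ M) ^ m * count (not ∘ ΞEmpty) Outs
    ≤⟨ *-monoʳ-≤ ((16 ^ M) ^ m) (count-mono T-not-ΞEmpty⇒solvable Outs) ⟩
  (16 ^ M) ^ m * count (λ ω → any (solves ω) (candidates M a m)) Outs
    ≤⟨ *-monoʳ-≤ ((16 ^ M) ^ m) (count-any≤sum solves (candidates M a m) Outs) ⟩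
  (16 ^ M) ^ m * sum (map (λ p → count (λ ω → solves ω p) Outs) (candidates M a m))
    ≤⟨ *-sum≤length* ((16 ^ M) ^ m) (λ p → count (λ ω → solves ω p) Outs) (count-solves≤ M a m 837≤M) (candidates M a m) ⟩
  length (candidates M a m) * length Outs ∎
  where
  open ≤-Reasoning
  Outs = outcomes M a m

x≤ceilDiv*d : ∀ x d .{{_ : NonZero d}} → x ≤ ceilDiv x d * d
x≤ceilDiv*d x (suc d) = +-cancelˡ-≤ d x _ (begin
  d + x                                          ≡⟨ +-comm d x ⟩
  x + d                                          ≡⟨ m≡m%n+[m/n]*n (x + d) (suc d) ⟩
  (x + d) % suc d + ceilDiv x (suc d) * suc d ≤⟨ +-monoˡ-≤ _ (s≤s⁻¹ (m%n<n (x + d) (suc d))) ⟩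
  d + ceilDiv x (suc d) * suc d                  ∎)
  where open ≤-Reasoning

2·16^n·2^[n-M+e]≤16^e : ∀ a M e → 1 ≤ M → 2 * (a + M) ≤ e → (16 ^ (a + M) + 16 ^ (a + M)) * 2 ^ (a + e) ≤ 16 ^ e
2·16^n·2^[n-M+e]≤16^e a M e 1≤M 2n≤e = begin
  (16 ^ n + 16 ^ n) * 2 ^ (a + e)  ≡⟨ cong (λ x → (x + x) * 2 ^ (a + e)) (^-*-assoc 2 4 n) ⟩
  (2 ^ (4 * n) + 2 ^ (4 * n)) * 2 ^ (a + e)
                                   ≡⟨ cong (λ x → (2 ^ (4 * n) + x) * 2 ^ (a + e)) (+-identityʳ _) ⟨
  2 ^ suc (4 * n) * 2 ^ (a + e)    ≡⟨ ^-distribˡ-+-* 2 (suc (4 * n)) (a + e) ⟨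
  2 ^ (suc (4 * n) + (a + e))      ≤⟨ ^-monoʳ-≤ 2 exponent ⟩
  2 ^ (4 * e)                      ≡⟨ ^-*-assoc 2 4 e ⟨
  16 ^ e                           ∎
  where
  open ≤-Reasoning
  n = a + M
  1+a≤2n : suc a ≤ 2 * n
  1+a≤2n = ≤-trans (subst (_≤ a + M) (+-comm a 1) (+-monoʳ-≤ a 1≤M)) (m≤m+n n (n + 0))
  e₁ : ∀ n a e → suc (4 * n) + (a + e) ≡ 4 * n + suc a + e
  e₁ = solve-∀
  e₂ : ∀ n e → 4 * n + 2 * n + e ≡ 3 * (2 * n) + e
  e₂ = solve-∀
  e₃ : ∀ e → 3 * e + e ≡ 4 * e
  e₃ = solve-∀
  exponent : suc (4 * n) + (a + e) ≤ 4 * e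
  exponent = begin
    suc (4 * n) + (a + e) ≡⟨ e₁ n a e ⟩
    4 * n + suc a + e     ≤⟨ +-monoˡ-≤ e (+-monoʳ-≤ (4 * n) 1+a≤2n) ⟩
    4 * n + 2 * n + e     ≡⟨ e₂ n e ⟩
    3 * (2 * n) + e       ≤⟨ +-monoˡ-≤ e (*-monoʳ-≤ 3 2n≤e) ⟩
    3 * e + e             ≡⟨ e₃ e ⟩
    4 * e                 ∎

length-candidates : ∀ M a m → length (candidates M a m) ≡ 2 ^ a * 2 ^ (M * m)
length-candidates M a m = begin
  length (candidates M a m)                                       ≡⟨ length-cartesianProduct (allFuns bools a) _ ⟩
  length (allFuns bools a) * length (allFuns (allFuns bools M) m) ≡⟨ cong₂ _*_ (length-allFuns bools a) (length-allFuns _ m) ⟩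
  2 ^ a * length (allFuns bools M) ^ m                            ≡⟨ cong (λ x → 2 ^ a * x ^ m) (length-allFuns bools M) ⟩
  2 ^ a * (2 ^ M) ^ m                                             ≡⟨ cong (2 ^ a *_) (^-*-assoc 2 M m) ⟩
  2 ^ a * 2 ^ (M * m)                                             ∎
  where open ≡-Reasoning

count-Ξnonempty*2·16^n≤length : ∀ M .{{_ : NonZero M}} → 837 ≤ M → ∀ a →
  let n = a + M ; m = ceilDiv (2 * n) M in
  count (not ∘ ΞEmpty) (outcomes M a m) * (16 ^ n + 16 ^ n) ≤ length (outcomes M a m)
count-Ξnonempty*2·16^n≤length M 837≤M a = *-cancelˡ-≤ K {{m^n≢0 2 (a + e)}} (begin
  K * (bad * (16 ^ n + 16 ^ n))      ≡⟨ e₁ K bad (16 ^ n + 16 ^ n) ⟩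
  bad * ((16 ^ n + 16 ^ n) * K)      ≤⟨ *-monoʳ-≤ bad (2·16^n·2^[n-M+e]≤16^e a M e 1≤M 2n≤e) ⟩
  bad * 16 ^ e                       ≡⟨ cong (bad *_) (^-*-assoc 16 M m) ⟨
  bad * (16 ^ M) ^ m                 ≡⟨ *-comm bad _ ⟩
  (16 ^ M) ^ m * bad                 ≤⟨ count-Ξnonempty≤ M a m 837≤M ⟩
  length (candidates M a m) * len    ≡⟨ cong (_* len) (trans (length-candidates M a m) (sym (^-distribˡ-+-* 2 a e))) ⟩
  K * len                            ∎)
  where
  open ≤-Reasoning
  n = a + M
  m = ceilDiv (2 * n) M
  e = M * m
  K = 2 ^ (a + e)
  bad = count (not ∘ ΞEmpty) (outcomes M a m)
  len = length (outcomes M a m)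
  1≤M : 1 ≤ M
  1≤M = ≤-trans (s≤s z≤n) 837≤M
  2n≤e : 2 * n ≤ e
  2n≤e = ≤-trans (x≤ceilDiv*d (2 * n) M) (≤-reflexive (*-comm m M))
  e₁ : ∀ K b x → K * (b * x) ≡ b * (x * K)
  e₁ = solve-∀

1-prob≡count-not/length : ∀ {Ω : Set} ω (ωs : List Ω) P →
  1ℚ - prob (ω ∷ ωs) P ≡ + count (not ∘ P) (ω ∷ ωs) ℚ./ length (ω ∷ ωs)
1-prob≡count-not/length ω ωs P = begin
  1ℚ - X             ≡⟨ cong (_- X) X+Y≡1 ⟨
  (X ℚ.+ Y) - X      ≡⟨ cong (ℚ._- X) (ℚProp.+-comm X Y) ⟩
  (Y ℚ.+ X) - X      ≡⟨ ℚProp.+-assoc Y X (ℚ.- X) ⟩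
  Y ℚ.+ (X - X)      ≡⟨ cong (Y ℚ.+_) (ℚProp.+-inverseʳ X) ⟩
  Y ℚ.+ 0ℚ           ≡⟨ ℚProp.+-identityʳ Y ⟩
  Y                  ∎
  where
  open ≡-Reasoning
  xs = ω ∷ ωs
  X = + count P xs ℚ./ length xs
  Y = + count (not ∘ P) xs ℚ./ length xs
  len/len≡1 : + length xs ℚ./ length xs ≡ 1ℚ
  len/len≡1 = ℚProp.≤-antisym (+m/n≤+o/p (length xs) (length xs) 1 1 (≤-reflexive (*-comm (length xs) 1)))
                              (+m/n≤+o/p 1 1 (length xs) (length xs) (≤-reflexive (*-comm 1 (length xs))))
  X+Y≡1 : X ℚ.+ Y ≡ 1ℚ
  X+Y≡1 = trans (+m/n++o/n (count P xs) _ (length xs))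
                (trans (cong (λ c → + c ℚ./ length xs) (count+count-not≡length P xs)) len/len≡1)

0<length-outcomes : ∀ M a m → 0 < length (outcomes M a m)
0<length-outcomes M a m =
  subst (0 <_) (sym (length-cartesianProduct (allFuns (allFuns bools a) M) _))
        (*-mono-≤ (0<length-allFuns _ M (0<length-allFuns bools a (s≤s z≤n)))
                  (0<length-allFuns _ m (0<length-allFuns _ M (0<length-allFuns bools M (s≤s z≤n)))))

1-prob≤e^- : ∀ {Ω : Set} (xs : List Ω) P n B → 0 < length xs → count (not ∘ P) xs * B ≤ length xs →
             (∀ k → expPartial n k ℚ.≤ + B ℚ./ 1) → (1ℚ - prob xs P) ≤e^- n
1-prob≤e^- (ω ∷ ωs) P n B _ bad*B≤len expPartial≤B k = begin
  (1ℚ - prob (ω ∷ ωs) P) ℚ.* expPartial n k ≡⟨ cong (ℚ._* expPartial n k) (1-prob≡count-not/length ω ωs P) ⟩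
  Y ℚ.* expPartial n k                     ≤⟨ ℚProp.*-monoˡ-≤-nonNeg Y {{ℚProp.normalize-nonNeg bad len}} (expPartial≤B k) ⟩
  Y ℚ.* (+ B ℚ./ 1)                        ≡⟨ +m/n*+o/p bad len B 1 ⟩
  + (bad * B) ℚ./ (len * 1)                ≤⟨ +m/n≤+o/p (bad * B) (len * 1) 1 1 (begin-nat) ⟩
  1ℚ                                       ∎
  where
  open ℚProp.≤-Reasoning
  bad = count (not ∘ P) (ω ∷ ωs)
  len = length (ω ∷ ωs)
  Y = + bad ℚ./ len
  begin-nat : bad * B * 1 ≤ 1 * (len * 1)
  begin-nat = ≤-trans (≤-reflexive (*-identityʳ _)) (≤-trans bad*B≤len (≤-reflexive (sym (trans (*-identityˡ _) (*-identityʳ _)))))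

proposition4p3 : ∃ λ M₀ → ∀ (M : ℕ) → .{{_ : NonZero M}} → M₀ ≤ M → ∀ (a : ℕ) →
    let n = a + M
        m = ceilDiv (2 * n) M
    in (1ℚ - prob (outcomes M a m) ΞEmpty) ≤e^- n
proposition4p3 = 837 , λ M 837≤M a →
  1-prob≤e^- (outcomes M a _) ΞEmpty (a + M) _ (0<length-outcomes M a _)
    (count-Ξnonempty*2·16^n≤length M 837≤M a) (expPartial≤2·16^n (a + M))
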